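{- Let $x,y\in\mathfrak{A}_N$ be permutations all of whose cycles have odd length. If $x\le_{\mathbf 3}y$, then $x\le_{\mathbf 2}y$.
   Context: $\mathfrak{S}_N$ is the symmetric group on $[N]$, $\mathfrak{A}_N$ the alternating group. Cycles include fixed points (length $1$). $\ell_{\mathbf 2}(x)$ is the minimal number of transpositions with product $x$, and $x\le_{\mathbf 2}y$ iff $\ell_{\mathbf 2}(y)=\ell_{\mathbf 2}(x)+\ell_{\mathbf 2}(x^{ -1}y)$; for $x\in\mathfrak A_N$, $\ell_{\mathbf 3}(x)$ is the minimal number of $3$-cycles with product $x$, and $x\le_{\mathbf 3}y$ iff $\ell_{\mathbf 3}(y)=\ell_{\mathbf 3}(x)+\ell_{\mathbf 3}(x^{ -1}y)$. -}

module Defs where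

open import Data.Nat using (ℕ; zero; suc; _+_; _*_; _<_)
open import Data.Fin using (Fin)
open import Data.Fin.Permutation using (Permutation′; _⟨$⟩ʳ_; _≈_; id; flip; _∘ₚ_; transpose)
open import Data.List using (List; []; _∷_; length)
open import Data.Product using (Σ; ∃; ∃-syntax; _×_; _,_)
open import Relation.Binary.PropositionalEquality using (_≡_; _≢_)
open import Relation.Nullary using (¬_)

-- Group product in the usual function-composition convention:
-- (x · y) i = x (y i).
infixl 7 _·_
_·_ : ∀ {N} → Permutation′ N → Permutation′ N → Permutation′ N
x · y = y ∘ₚ x

_⁻¹ : ∀ {N} → Permutation′ N → Permutation′ N
x ⁻¹ = flip x

record Transp (N : ℕ) : Set where
  constructor tr
  field
    a b : Fin N
    a≢b : a ≢ b

transp : ∀ {N} → Transp N → Permutation′ N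
transp (tr a b _) = transpose a b

-- A 3-cycle (a b c) with a, b, c pairwise distinct: a ↦ b ↦ c ↦ a.
record ThreeCycle (N : ℕ) : Set where
  constructor cyc
  field
    a b c : Fin N
    a≢b : a ≢ b
    b≢c : b ≢ c
    a≢c : a ≢ c

-- (a b c) = (a c)(a b) as a product of transpositions (functions composed right-to-left):
-- a ↦ b, b ↦ a ↦ c, c ↦ a.
threeCycle : ∀ {N} → ThreeCycle N → Permutation′ N
threeCycle (cyc a b c _ _ _) = transpose a c · transpose a b

prod : ∀ {N} {G : Set} → (G → Permutation′ N) → List G → Permutation′ N
prod g []       = id
prod g (s ∷ ss) = g s · prod g ss

ProdTransp : ∀ {N} → ℕ → Permutation′ N → Set
ProdTransp {N} k x = Σ (List (Transp N)) λ ts → length ts ≡ k × prod transp ts ≈ x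

Prod3 : ∀ {N} → ℕ → Permutation′ N → Set
Prod3 {N} k x = Σ (List (ThreeCycle N)) λ cs → length cs ≡ k × prod threeCycle cs ≈ x

IsLen₂ : ∀ {N} → Permutation′ N → ℕ → Set
IsLen₂ x k = ProdTransp k x × (∀ m → m < k → ¬ ProdTransp m x)

IsLen₃ : ∀ {N} → Permutation′ N → ℕ → Set
IsLen₃ x k = Prod3 k x × (∀ m → m < k → ¬ Prod3 m x)

_≤₂_ : ∀ {N} → Permutation′ N → Permutation′ N → Set
x ≤₂ y = ∃[ a ] ∃[ b ] (IsLen₂ x a × IsLen₂ (x ⁻¹ · y) b × IsLen₂ y (a + b))

_≤₃_ : ∀ {N} → Permutation′ N → Permutation′ N → Set
x ≤₃ y = ∃[ a ] ∃[ b ] (IsLen₃ x a × IsLen₃ (x ⁻¹ · y) b × IsLen₃ y (a + b))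

Alternating : ∀ {N} → Permutation′ N → Set
Alternating x = ∃[ m ] ProdTransp (2 * m) x

iter : ∀ {N} → Permutation′ N → ℕ → Fin N → Fin N
iter x zero    i = i
iter x (suc k) i = x ⟨$⟩ʳ iter x k i

CycleLen : ∀ {N} → Permutation′ N → Fin N → ℕ → Set
CycleLen x i k = 0 < k × iter x k i ≡ i × (∀ m → 0 < m → m < k → iter x m i ≢ i)

Odd : ℕ → Set
Odd k = ∃[ m ] k ≡ suc (2 * m)

AllCyclesOdd : ∀ {N} → Permutation′ N → Set
AllCyclesOdd x = ∀ i k → CycleLen x i k → Odd k

-- Let c(z) be the number of cycles of z ∈ 𝔖_N. Multiplying by a
-- transposition changes c by at most one, so z needs at least N − c(z)
-- transpositions, while a product of k 3-cycles is a product of 2k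
-- transpositions. If all cycles of z are odd, cutting two consecutive points
-- out of a cycle of length at least 3 is multiplication by a 3-cycle that
-- raises c by two and keeps all cycles odd; repeating this writes z as a
-- product of (N − c(z))/2 3-cycles. Hence ℓ₂ = 2ℓ₃ on permutations with odd
-- cycles, and then ℓ₃(y) = ℓ₃(x) + ℓ₃(x⁻¹y) together with ℓ₂(x⁻¹y) ≤ 2ℓ₃(x⁻¹y)
-- and the triangle inequality ℓ₂(y) ≤ ℓ₂(x) + ℓ₂(x⁻¹y) gives x ≤₂ y.

module Submission where

open import Data.Fin using (Fin; zero; suc; toℕ; fromℕ<)
open import Data.Fin.Permutation
  using (Permutation′; _⟨$⟩ʳ_; _⟨$⟩ˡ_; _≈_; id; transpose; inverseˡ; inverseʳ;
         remove; lift₀; lift₀-remove; lift₀-id; lift₀-transpose)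
open import Data.Fin.Permutation.Components using (transpose-inverse) renaming (transpose to τ)
import Data.Fin.Properties as Fin
open import Data.Fin.Properties using (_≟_)
open import Data.List using (List; []; _∷_; length; _++_)
open import Data.List.Properties using (length-++)
open import Data.Nat using (ℕ; zero; suc; _+_; _*_; _≤_; _<_; z≤n; s≤s)
open import Data.Nat.Divisibility using (_∣_; divides; m%n≡0⇒n∣m)
open import Data.Nat.DivMod using (_%_; _/_; m≡m%n+[m/n]*n; m%n<n)
open import Data.Nat.Properties
  using (suc-injective; +-identityʳ; +-suc; +-comm; *-suc; *-comm; *-assoc; *-distribˡ-+;
         ≤-refl; ≤-reflexive; ≤-trans; ≤-pred; ≤-<-trans; <⇒≤; <⇒≢; <⇒≱; ≰⇒>; <-irrefl; <-cmp; _≤?_;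
         m≤m+n; m≤n+m; n≤1+n; n<1+n; m<n+m; m≤n⇒∃[o]m+o≡n; m≤n⇒m<n∨m≡n;
         +-mono-≤; +-monoˡ-≤; +-monoʳ-≤; +-monoʳ-<; *-monoʳ-≤; +-cancelʳ-≤; even≢odd;
         module ≤-Reasoning)
open import Data.Product using (_,_; _×_; ∃-syntax; proj₁; proj₂)
open import Data.Sum using (_⊎_; inj₁; inj₂)
open import Function using (_∘_)
open import Relation.Binary.Definitions using (tri<; tri≈; tri>)
open import Relation.Binary.PropositionalEquality
open import Relation.Nullary using (Dec; yes; no; ¬_; contradiction)

open import Defs

private
  variable
    n : ℕ

-- Transpositions

-- Case analysis on `k ≟ a` by `with` would also abstract the test `k ≟ a`
-- inside the definition of τ; matching on this view leaves τ intact.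
data Compare {n} (i j : Fin n) : Set where
  same : i ≡ j → Compare i j
  diff : i ≢ j → Compare i j

infix 4 _≟?_
_≟?_ : (i j : Fin n) → Compare i j
i ≟? j with i ≟ j
... | yes i≡j = same i≡j
... | no i≢j  = diff i≢j

⟨$⟩ʳ-injective : (w : Permutation′ n) {i j : Fin n} → w ⟨$⟩ʳ i ≡ w ⟨$⟩ʳ j → i ≡ j
⟨$⟩ʳ-injective w {i} {j} eq = begin
  i                    ≡⟨ inverseˡ w ⟨
  w ⟨$⟩ˡ (w ⟨$⟩ʳ i)    ≡⟨ cong (w ⟨$⟩ˡ_) eq ⟩
  w ⟨$⟩ˡ (w ⟨$⟩ʳ j)    ≡⟨ inverseˡ w ⟩
  j                    ∎
  where open ≡-Reasoning

module _ (a b : Fin n) where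

  τ-ˡ : τ a b a ≡ b
  τ-ˡ with a ≟ a
  ... | yes _   = refl
  ... | no a≢a = contradiction refl a≢a

  τ-ʳ : τ a b b ≡ a
  τ-ʳ with b ≟ a
  ... | yes b≡a = b≡a
  ... | no _ with b ≟ b
  ...   | yes _   = refl
  ...   | no b≢b = contradiction refl b≢b

  τ-other : ∀ {k} → k ≢ a → k ≢ b → τ a b k ≡ k
  τ-other {k} k≢a k≢b with k ≟ a
  ... | yes k≡a = contradiction k≡a k≢a
  ... | no _ with k ≟ b
  ...   | yes k≡b = contradiction k≡b k≢b
  ...   | no _   = refl

τ-comm : (a b k : Fin n) → τ a b k ≡ τ b a k
τ-comm a b k with k ≟? a | k ≟? b
... | same refl | _        = trans (τ-ˡ k b) (sym (τ-ʳ b k))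
... | diff _     | same refl = trans (τ-ʳ a k) (sym (τ-ˡ k a))
... | diff k≢a   | diff k≢b   = trans (τ-other a b k≢a k≢b) (sym (τ-other b a k≢b k≢a))

τ-involutive : (a b k : Fin n) → τ a b (τ a b k) ≡ k
τ-involutive a b k = trans (cong (τ a b) (τ-comm a b k)) (transpose-inverse a b)

τ-diagonal : (a k : Fin n) → τ a a k ≡ k
τ-diagonal a k with k ≟? a
... | same refl = τ-ˡ k k
... | diff k≢a   = τ-other a a k≢a k≢a

τ-natural : (σ : Permutation′ n) (a b k : Fin n) →
            τ (σ ⟨$⟩ʳ a) (σ ⟨$⟩ʳ b) (σ ⟨$⟩ʳ k) ≡ σ ⟨$⟩ʳ τ a b k
τ-natural σ a b k with k ≟? a | k ≟? b
... | same refl | _         = trans (τ-ˡ (σ ⟨$⟩ʳ k) (σ ⟨$⟩ʳ b)) (cong (σ ⟨$⟩ʳ_) (sym (τ-ˡ k b)))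
... | diff _    | same refl = trans (τ-ʳ (σ ⟨$⟩ʳ a) (σ ⟨$⟩ʳ k)) (cong (σ ⟨$⟩ʳ_) (sym (τ-ʳ a k)))
... | diff k≢a  | diff k≢b  =
  trans (τ-other (σ ⟨$⟩ʳ a) (σ ⟨$⟩ʳ b) (k≢a ∘ ⟨$⟩ʳ-injective σ) (k≢b ∘ ⟨$⟩ʳ-injective σ))
        (cong (σ ⟨$⟩ʳ_) (sym (τ-other a b k≢a k≢b)))

transpose-cancelˡ : (a b : Fin n) (w : Permutation′ n) → transpose a b · (transpose a b · w) ≈ w
transpose-cancelˡ a b w i = τ-involutive a b (w ⟨$⟩ʳ i)

-- The number of cycles

δ₀ : Fin n → ℕ
δ₀ zero    = 1
δ₀ (suc _) = 0

unlink₀ : Permutation′ (suc n) → Permutation′ (suc n)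
unlink₀ z = transpose zero (z ⟨$⟩ʳ zero) · z

unlink₀-fixes-zero : (z : Permutation′ (suc n)) → unlink₀ z ⟨$⟩ʳ zero ≡ zero
unlink₀-fixes-zero z = τ-ʳ zero (z ⟨$⟩ʳ zero)

delete₀ : Permutation′ (suc n) → Permutation′ n
delete₀ z = remove zero (unlink₀ z)

suc-delete₀ : (z : Permutation′ (suc n)) (j : Fin n) →
              suc (delete₀ z ⟨$⟩ʳ j) ≡ unlink₀ z ⟨$⟩ʳ suc j
suc-delete₀ z j = lift₀-remove (unlink₀ z) (unlink₀-fixes-zero z) (suc j)

-- Cutting 0 out of its cycle leaves the other cycles intact, and 0 is a
-- cycle by itself exactly when z 0 = 0.
cycles : Permutation′ n → ℕ
cycles {zero}  _ = 0
cycles {suc n} z = δ₀ (z ⟨$⟩ʳ zero) + cycles (delete₀ z)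

delete₀-· : (x w : Permutation′ (suc n)) (σ : Permutation′ n) →
            (∀ k → unlink₀ x ⟨$⟩ʳ k ≡ lift₀ σ ⟨$⟩ʳ (unlink₀ w ⟨$⟩ʳ k)) →
            delete₀ x ≈ σ · delete₀ w
delete₀-· x w σ eq j = Fin.suc-injective (begin
  suc (delete₀ x ⟨$⟩ʳ j)                     ≡⟨ suc-delete₀ x j ⟩
  unlink₀ x ⟨$⟩ʳ suc j                       ≡⟨ eq (suc j) ⟩
  lift₀ σ ⟨$⟩ʳ (unlink₀ w ⟨$⟩ʳ suc j)        ≡⟨ cong (lift₀ σ ⟨$⟩ʳ_) (suc-delete₀ w j) ⟨
  lift₀ σ ⟨$⟩ʳ suc (delete₀ w ⟨$⟩ʳ j)        ∎)
  where open ≡-Reasoning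

cycles-cong : {z z′ : Permutation′ n} → z ≈ z′ → cycles z ≡ cycles z′
cycles-cong {zero}          _  = refl
cycles-cong {suc n} {z} {z′} eq =
  cong₂ _+_ (cong δ₀ (eq zero)) (cycles-cong (delete₀-· z z′ id unlink₀-eq))
  where
  unlink₀-eq : ∀ k → unlink₀ z ⟨$⟩ʳ k ≡ lift₀ id ⟨$⟩ʳ (unlink₀ z′ ⟨$⟩ʳ k)
  unlink₀-eq k = trans (cong₂ (τ zero) (eq zero) (eq k)) (sym (lift₀-id _))

cycles-id : cycles (id {n}) ≡ n
cycles-id {zero}  = refl
cycles-id {suc n} = cong suc (trans (cycles-cong delete₀-id) (cycles-id {n}))
  where
  delete₀-id : delete₀ (id {suc n}) ≈ id
  delete₀-id j = Fin.suc-injective (trans (suc-delete₀ id j) (τ-diagonal zero (suc j)))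

cycles-≤ : (z : Permutation′ n) → cycles z ≤ n
cycles-≤ {zero}  _ = z≤n
cycles-≤ {suc n} z = +-mono-≤ (δ₀-≤ (z ⟨$⟩ʳ zero)) (cycles-≤ (delete₀ z))
  where
  δ₀-≤ : (i : Fin (suc n)) → δ₀ i ≤ 1
  δ₀-≤ zero    = s≤s z≤n
  δ₀-≤ (suc _) = z≤n

module _ (x w : Permutation′ (suc n)) where

  cycles-unlink-id : (∀ k → unlink₀ x ⟨$⟩ʳ k ≡ unlink₀ w ⟨$⟩ʳ k) →
                     cycles x ≡ δ₀ (x ⟨$⟩ʳ zero) + cycles (delete₀ w)
  cycles-unlink-id eq = cong (δ₀ (x ⟨$⟩ʳ zero) +_)
    (cycles-cong (delete₀-· x w id λ k → trans (eq k) (sym (lift₀-id _))))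

  cycles-unlink-transpose :
    ∀ {p q} → (∀ k → unlink₀ x ⟨$⟩ʳ k ≡ τ (suc p) (suc q) (unlink₀ w ⟨$⟩ʳ k)) →
    cycles x ≡ δ₀ (x ⟨$⟩ʳ zero) + cycles (transpose p q · delete₀ w)
  cycles-unlink-transpose {p} {q} eq = cong (δ₀ (x ⟨$⟩ʳ zero) +_)
    (cycles-cong (delete₀-· x w (transpose p q) λ k → trans (eq k) (lift₀-transpose p q _)))

delete₀-fixes : (w : Permutation′ (suc n)) {p : Fin n} →
                w ⟨$⟩ʳ suc p ≡ suc p → delete₀ w ⟨$⟩ʳ p ≡ p
delete₀-fixes w {p} wp≡p = Fin.suc-injective (begin
  suc (delete₀ w ⟨$⟩ʳ p)                 ≡⟨ suc-delete₀ w p ⟩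
  τ zero (w ⟨$⟩ʳ zero) (w ⟨$⟩ʳ suc p)    ≡⟨ cong (τ zero (w ⟨$⟩ʳ zero)) wp≡p ⟩
  τ zero (w ⟨$⟩ʳ zero) (suc p)           ≡⟨ τ-other zero (w ⟨$⟩ʳ zero) (≢-sym Fin.0≢1+n) p≢w0 ⟩
  suc p                                  ∎)
  where
  open ≡-Reasoning
  p≢w0 : suc p ≢ w ⟨$⟩ʳ zero
  p≢w0 eq = Fin.0≢1+n (⟨$⟩ʳ-injective w (sym (trans wp≡p eq)))

cycles-transpose-zero-fixed : (w : Permutation′ (suc n)) (q : Fin n) → w ⟨$⟩ʳ zero ≡ zero →
                              suc (cycles (transpose zero (suc q) · w)) ≡ cycles w
cycles-transpose-zero-fixed w q w0≡0 = begin
  suc (cycles x)                    ≡⟨ cong suc (cycles-unlink-id x w unlink₀-eq) ⟩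
  suc (δ₀ (x ⟨$⟩ʳ zero) + cycles (delete₀ w)) ≡⟨ cong (λ i → suc (δ₀ i + cycles (delete₀ w))) x0≡q ⟩
  suc (cycles (delete₀ w))          ≡⟨ cong (λ i → δ₀ i + cycles (delete₀ w)) w0≡0 ⟨
  cycles w                          ∎
  where
  open ≡-Reasoning
  x = transpose zero (suc q) · w
  x0≡q : x ⟨$⟩ʳ zero ≡ suc q
  x0≡q = trans (cong (τ zero (suc q)) w0≡0) (τ-ˡ zero (suc q))
  unlink₀-eq : ∀ k → unlink₀ x ⟨$⟩ʳ k ≡ unlink₀ w ⟨$⟩ʳ k
  unlink₀-eq k = begin
    τ zero (x ⟨$⟩ʳ zero) (x ⟨$⟩ʳ k)  ≡⟨ cong (λ i → τ zero i (x ⟨$⟩ʳ k)) x0≡q ⟩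
    τ zero (suc q) (x ⟨$⟩ʳ k)        ≡⟨ τ-involutive zero (suc q) (w ⟨$⟩ʳ k) ⟩
    w ⟨$⟩ʳ k                         ≡⟨ τ-diagonal zero (w ⟨$⟩ʳ k) ⟨
    τ zero zero (w ⟨$⟩ʳ k)           ≡⟨ cong (λ i → τ zero i (w ⟨$⟩ʳ k)) w0≡0 ⟨
    unlink₀ w ⟨$⟩ʳ k                 ∎

cycles-transpose-fixed : (w : Permutation′ n) {p q : Fin n} → w ⟨$⟩ʳ p ≡ p → p ≢ q →
                         suc (cycles (transpose p q · w)) ≡ cycles w

cycles-transpose-fixed-step :
  (x w : Permutation′ (suc n)) {p q : Fin n} → w ⟨$⟩ʳ suc p ≡ suc p → p ≢ q →
  δ₀ (x ⟨$⟩ʳ zero) ≡ δ₀ (w ⟨$⟩ʳ zero) →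
  (∀ k → unlink₀ x ⟨$⟩ʳ k ≡ τ (suc p) (suc q) (unlink₀ w ⟨$⟩ʳ k)) →
  suc (cycles x) ≡ cycles w
cycles-transpose-fixed-step x w {p} {q} wp≡p p≢q δ-eq unlink₀-eq = begin
  suc (cycles x)                                              ≡⟨ cong suc (cycles-unlink-transpose x w unlink₀-eq) ⟩
  suc (δ₀ (x ⟨$⟩ʳ zero) + cycles (transpose p q · delete₀ w)) ≡⟨ cong (λ d → suc (d + _)) δ-eq ⟩
  suc (δ₀ (w ⟨$⟩ʳ zero) + cycles (transpose p q · delete₀ w)) ≡⟨ +-suc _ _ ⟨
  δ₀ (w ⟨$⟩ʳ zero) + suc (cycles (transpose p q · delete₀ w)) ≡⟨ cong (δ₀ (w ⟨$⟩ʳ zero) +_) merged ⟩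
  cycles w                                                    ∎
  where
  open ≡-Reasoning
  merged = cycles-transpose-fixed (delete₀ w) (delete₀-fixes w wp≡p) p≢q

cycles-transpose-fixed {suc n} w {zero}  {zero}  _    0≢0 = contradiction refl 0≢0
cycles-transpose-fixed {suc n} w {zero}  {suc q} w0≡0 _   = cycles-transpose-zero-fixed w q w0≡0
cycles-transpose-fixed {suc n} w {suc p} {zero}  wp≡p _   = split (w ⟨$⟩ʳ zero) refl
  where
  x = transpose (suc p) zero · w
  split : ∀ r → w ⟨$⟩ʳ zero ≡ r → suc (cycles x) ≡ cycles w
  split zero    w0≡0 = trans (cong suc (cycles-cong {z = x} {z′ = transpose zero (suc p) · w}
                                         λ k → τ-comm (suc p) zero (w ⟨$⟩ʳ k)))
                             (cycles-transpose-zero-fixed w p w0≡0)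
  split (suc r) w0≡r =
    cycles-transpose-fixed-step x w wp≡p (r≢p ∘ cong suc ∘ sym)
      (trans (cong δ₀ x0≡r) (cong δ₀ (sym w0≡r))) unlink₀-eq
    where
    r≢p : suc r ≢ suc p
    r≢p r≡p = Fin.0≢1+n (⟨$⟩ʳ-injective w (trans (trans w0≡r r≡p) (sym wp≡p)))
    x0≡r : x ⟨$⟩ʳ zero ≡ suc r
    x0≡r = trans (cong (τ (suc p) zero) w0≡r) (τ-other (suc p) zero r≢p (≢-sym Fin.0≢1+n))
    -- Conjugating (p 0) by (0 r) gives (p r).
    unlink₀-eq : ∀ k → unlink₀ x ⟨$⟩ʳ k ≡ τ (suc p) (suc r) (unlink₀ w ⟨$⟩ʳ k)
    unlink₀-eq k = begin
      τ zero (x ⟨$⟩ʳ zero) (τ (suc p) zero m)  ≡⟨ cong (λ i → τ zero i (τ (suc p) zero m)) x0≡r ⟩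
      τ zero (suc r) (τ (suc p) zero m)        ≡⟨ τ-natural (transpose zero (suc r)) (suc p) zero m ⟨
      τ (τ zero (suc r) (suc p)) (τ zero (suc r) zero) (τ zero (suc r) m)
                                               ≡⟨ cong₂ (λ i j → τ i j (τ zero (suc r) m))
                                                        (τ-other zero (suc r) (≢-sym Fin.0≢1+n) (≢-sym r≢p)) (τ-ˡ zero (suc r)) ⟩
      τ (suc p) (suc r) (τ zero (suc r) m)     ≡⟨ cong (λ i → τ (suc p) (suc r) (τ zero i m)) w0≡r ⟨
      τ (suc p) (suc r) (unlink₀ w ⟨$⟩ʳ k)     ∎
      where
      open ≡-Reasoning
      m = w ⟨$⟩ʳ k
cycles-transpose-fixed {suc n} w {suc p} {suc q} wp≡p p≢q =
  cycles-transpose-fixed-step x w wp≡p (p≢q ∘ cong suc) (δ₀-τ-suc (w ⟨$⟩ʳ zero)) unlink₀-eq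
  where
  x = transpose (suc p) (suc q) · w
  δ₀-τ-suc : ∀ i → δ₀ (τ (suc p) (suc q) i) ≡ δ₀ i
  δ₀-τ-suc zero    = cong δ₀ (τ-other (suc p) (suc q) Fin.0≢1+n Fin.0≢1+n)
  δ₀-τ-suc (suc i) = cong δ₀ (lift₀-transpose p q (suc i))
  -- (p q) fixes 0, so conjugating (0 (w 0)) by it gives (0 (x 0)).
  unlink₀-eq : ∀ k → unlink₀ x ⟨$⟩ʳ k ≡ τ (suc p) (suc q) (unlink₀ w ⟨$⟩ʳ k)
  unlink₀-eq k =
    trans (cong (λ i → τ i (x ⟨$⟩ʳ zero) (x ⟨$⟩ʳ k)) (sym (τ-other (suc p) (suc q) Fin.0≢1+n Fin.0≢1+n)))
          (τ-natural (transpose (suc p) (suc q)) zero (w ⟨$⟩ʳ zero) (w ⟨$⟩ʳ k))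

cycles-transpose-≤ : (w : Permutation′ n) {a b : Fin n} → a ≢ b →
                     cycles w ≤ suc (cycles (transpose a b · w))
cycles-transpose-≤ {n} w = bounded n w (m≤m+n n (cycles w))
  where
  -- The recursion moves to a permutation with one cycle more; k bounds how
  -- often that can happen.
  bounded : ∀ k (w : Permutation′ n) {a b} → n ≤ k + cycles w → a ≢ b →
            cycles w ≤ suc (cycles (transpose a b · w))
  bounded k w {a} {b} bound a≢b = by-cases (w ⟨$⟩ʳ a ≟? a)
    where
    open ≤-Reasoning
    by-cases : Compare (w ⟨$⟩ʳ a) a → cycles w ≤ suc (cycles (transpose a b · w))
    by-cases (same wa≡a) = ≤-reflexive (sym (cycles-transpose-fixed w wa≡a a≢b))
    by-cases (diff wa≢a) = moved k bound (b ≟? a′)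
      where
      a′  = w ⟨$⟩ʳ a
      w₀  = transpose a a′ · w
      cycles-w₀ : suc (cycles w) ≡ cycles w₀
      cycles-w₀ = trans (cong suc (sym (cycles-cong (transpose-cancelˡ a a′ w))))
                        (cycles-transpose-fixed w₀ (τ-ʳ a a′) (≢-sym wa≢a))
      moved : ∀ k → n ≤ k + cycles w → Compare b a′ → cycles w ≤ suc (cycles (transpose a b · w))
      moved _ _ (same b≡a′) = begin
        cycles w                         ≤⟨ n≤1+n (cycles w) ⟩
        suc (cycles w)                   ≡⟨ cycles-w₀ ⟩
        cycles w₀                        ≤⟨ n≤1+n (cycles w₀) ⟩
        suc (cycles w₀)                  ≡⟨ cong suc (cycles-cong {z = w₀} {z′ = transpose a b · w}
                                               λ i → cong (λ c → τ a c (w ⟨$⟩ʳ i)) (sym b≡a′)) ⟩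
        suc (cycles (transpose a b · w)) ∎
      moved zero bound (diff _) = contradiction (begin-strict
        n              ≤⟨ bound ⟩
        cycles w       <⟨ n<1+n (cycles w) ⟩
        suc (cycles w) ≡⟨ cycles-w₀ ⟩
        cycles w₀      ≤⟨ cycles-≤ w₀ ⟩
        n              ∎) (<-irrefl refl)
      moved (suc k) bound (diff b≢a′) = begin
        cycles w                                     ≤⟨ ≤-pred (subst (_≤ suc (cycles v)) (sym cycles-w₀) ih) ⟩
        cycles v                                     ≡⟨ cycles-transpose-fixed v v-fixes-a (≢-sym wa≢a) ⟨
        suc (cycles (transpose a a′ · v))            ≡⟨ cong suc (cycles-cong {z = transpose a a′ · v}
                                                          {z′ = transpose a b · w} conj) ⟩
        suc (cycles (transpose a b · w))             ∎
        where
        v = transpose a′ b · w₀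
        ih : cycles w₀ ≤ suc (cycles v)
        ih = bounded k w₀ (≤-trans bound (≤-reflexive (trans (sym (+-suc k (cycles w)))
                                                        (cong (k +_) cycles-w₀))))
                          (≢-sym b≢a′)
        v-fixes-a : v ⟨$⟩ʳ a ≡ a
        v-fixes-a = trans (cong (τ a′ b) (τ-ʳ a a′)) (τ-other a′ b (≢-sym wa≢a) a≢b)
        conj : ∀ i → τ a a′ (τ a′ b (τ a a′ (w ⟨$⟩ʳ i))) ≡ τ a b (w ⟨$⟩ʳ i)
        conj i = trans (sym (τ-natural (transpose a a′) a′ b (τ a a′ m)))
                 (trans (cong₂ (λ c d → τ c d (τ a a′ (τ a a′ m))) (τ-ʳ a a′) (τ-other a a′ (≢-sym a≢b) b≢a′))
                        (cong (τ a b) (τ-involutive a a′ m)))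
          where m = w ⟨$⟩ʳ i

n≤length+cycles : (ts : List (Transp n)) → n ≤ length ts + cycles (prod transp ts)
n≤length+cycles []                 = ≤-reflexive (sym cycles-id)
n≤length+cycles {n} (tr a b a≢b ∷ ts) = begin
  n                                       ≤⟨ n≤length+cycles ts ⟩
  length ts + cycles w                    ≤⟨ +-monoʳ-≤ (length ts) (cycles-transpose-≤ w a≢b) ⟩
  length ts + suc (cycles (transpose a b · w)) ≡⟨ +-suc (length ts) _ ⟩
  suc (length ts) + cycles (transpose a b · w) ∎
  where
  open ≤-Reasoning
  w = prod transp ts

ProdTransp⇒n≤ : ∀ {m} (z : Permutation′ n) → ProdTransp m z → n ≤ m + cycles z
ProdTransp⇒n≤ z (ts , refl , prod≈z) =
  ≤-trans (n≤length+cycles ts) (≤-reflexive (cong (length ts +_) (cycles-cong prod≈z)))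

-- Parity and orbits

odd⊎even : ∀ k → Odd k ⊎ ∃[ m ] k ≡ 2 * m
odd⊎even zero    = inj₂ (0 , refl)
odd⊎even (suc k) with odd⊎even k
... | inj₁ (m , refl) = inj₂ (suc m , cong suc (sym (+-suc m (m + 0))))
... | inj₂ (m , refl) = inj₁ (m , refl)

odd-∣ : ∀ {k K} → k ∣ K → Odd K → Odd k
odd-∣ {k} (divides q refl) (m , qk≡1+2m) with odd⊎even k
... | inj₁ k-odd     = k-odd
... | inj₂ (j , refl) = contradiction (trans (sym qk≡2qj) qk≡1+2m) (even≢odd (q * j) m)
  where
  qk≡2qj : q * (2 * j) ≡ 2 * (q * j)
  qk≡2qj = trans (sym (*-assoc q 2 j)) (trans (cong (_* j) (*-comm q 2)) (*-assoc 2 q j))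

¬odd-2 : ¬ Odd 2
¬odd-2 (m , 2≡1+2m) = even≢odd 1 m 2≡1+2m

odd-2+ : ∀ {k} → Odd (2 + k) → Odd k
odd-2+ (suc m , 2+k≡1+2m) = m , trans (suc-injective (suc-injective 2+k≡1+2m)) (+-suc m (m + 0))

least-positive : {P : ℕ → Set} → (∀ k → Dec (P k)) → ∀ {m} → 0 < m → P m →
                 ∃[ k ] (0 < k × P k × (∀ j → 0 < j → j < k → ¬ P j))
least-positive {P} P? {suc d} _ Pm = search 1 d (s≤s z≤n) none-below-1 Pm
  where
  none-below-1 : ∀ j → 0 < j → j < 1 → ¬ P j
  none-below-1 (suc _) _ (s≤s ())
  search : ∀ k d → 0 < k → (∀ j → 0 < j → j < k → ¬ P j) → P (k + d) →
           ∃[ k ] (0 < k × P k × (∀ j → 0 < j → j < k → ¬ P j))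
  search k d 0<k below Pk+d with P? k
  ... | yes Pk = k , 0<k , Pk , below
  search k zero    _ _ Pk+d | no ¬Pk = contradiction (subst P (+-identityʳ k) Pk+d) ¬Pk
  search k (suc d) _ below Pk+d | no ¬Pk = search (suc k) d (s≤s z≤n) below′ (subst P (+-suc k d) Pk+d)
    where
    below′ : ∀ j → 0 < j → j < suc k → ¬ P j
    below′ j 0<j j<1+k with m≤n⇒m<n∨m≡n (≤-pred j<1+k)
    ... | inj₁ j<k  = below j 0<j j<k
    ... | inj₂ refl = ¬Pk

module _ (z : Permutation′ n) where

  iter-+ : ∀ m k i → iter z (m + k) i ≡ iter z m (iter z k i)
  iter-+ zero    k i = refl
  iter-+ (suc m) k i = cong (z ⟨$⟩ʳ_) (iter-+ m k i)

  iter-injective : ∀ m {i j} → iter z m i ≡ iter z m j → i ≡ j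
  iter-injective zero    eq = eq
  iter-injective (suc m) eq = iter-injective m (⟨$⟩ʳ-injective z eq)

  iter-periodic-* : ∀ {k i} → iter z k i ≡ i → ∀ q → iter z (q * k) i ≡ i
  iter-periodic-*         zk≡i zero    = refl
  iter-periodic-* {k} {i} zk≡i (suc q) =
    trans (iter-+ k (q * k) i) (trans (cong (iter z k) (iter-periodic-* zk≡i q)) zk≡i)

  iter-periodic-% : ∀ {k i} → iter z (suc k) i ≡ i → ∀ x → iter z x i ≡ iter z (x % suc k) i
  iter-periodic-% {k} {i} period x = begin
    iter z x i                                               ≡⟨ cong (λ y → iter z y i) (m≡m%n+[m/n]*n x (suc k)) ⟩
    iter z (x % suc k + x / suc k * suc k) i                 ≡⟨ iter-+ (x % suc k) _ i ⟩
    iter z (x % suc k) (iter z (x / suc k * suc k) i)        ≡⟨ cong (iter z (x % suc k)) (iter-periodic-* period (x / suc k)) ⟩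
    iter z (x % suc k) i                                     ∎
    where open ≡-Reasoning

  iter-collision : ∀ {x y i} → x < y → iter z x i ≡ iter z y i →
                   ∃[ d ] x + suc d ≡ y × iter z (suc d) i ≡ i
  iter-collision {x} {y} {i} x<y zx≡zy with m≤n⇒∃[o]m+o≡n x<y
  ... | d , 1+x+d≡y = d , x+1+d≡y , sym (iter-injective x (begin
    iter z x i                   ≡⟨ zx≡zy ⟩
    iter z y i                   ≡⟨ cong (λ y → iter z y i) x+1+d≡y ⟨
    iter z (x + suc d) i         ≡⟨ iter-+ x (suc d) i ⟩
    iter z x (iter z (suc d) i)  ∎))
    where
    open ≡-Reasoning
    x+1+d≡y = trans (+-suc x d) 1+x+d≡y

  cycleLen-exists : ∀ i → ∃[ k ] CycleLen z i k
  cycleLen-exists i with Fin.pigeonhole (n<1+n n) (λ j → iter z (toℕ j) i)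
  ... | x , y , x<y , zx≡zy with iter-collision x<y zx≡zy
  ...   | d , _ , return = least-positive {P = λ k → iter z k i ≡ i} (λ k → iter z k i ≟ i) {suc d} (s≤s z≤n) return

  cycleLen-injective : ∀ {i k x y} → CycleLen z i k → x < k → y < k →
                       iter z x i ≡ iter z y i → x ≡ y
  cycleLen-injective {x = x} {y} (_ , _ , minimal) x<k y<k zx≡zy with <-cmp x y
  ... | tri≈ _ x≡y _ = x≡y
  ... | tri< x<y _ _ with iter-collision x<y zx≡zy
  ...   | d , x+1+d≡y , return =
    contradiction return (minimal (suc d) (s≤s z≤n) (≤-<-trans (≤-trans (m≤n+m (suc d) x) (≤-reflexive x+1+d≡y)) y<k))
  cycleLen-injective {x = x} {y} (_ , _ , minimal) x<k y<k zx≡zy | tri> _ _ y<x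
    with iter-collision y<x (sym zx≡zy)
  ... | d , y+1+d≡x , return =
    contradiction return (minimal (suc d) (s≤s z≤n) (≤-<-trans (≤-trans (m≤n+m (suc d) y) (≤-reflexive y+1+d≡x)) x<k))

  cycleLen-∣ : ∀ {i k K} → CycleLen z i k → iter z K i ≡ i → k ∣ K
  cycleLen-∣ {i} {suc k} {K} (_ , period , minimal) zK≡i with K % suc k in r≡
  ... | zero  = m%n≡0⇒n∣m K (suc k) r≡
  ... | suc r = contradiction (begin
    iter z (suc r) i       ≡⟨ cong (λ y → iter z y i) r≡ ⟨
    iter z (K % suc k) i   ≡⟨ iter-periodic-% period K ⟨
    iter z K i             ≡⟨ zK≡i ⟩
    i                      ∎)
    (minimal (suc r) (s≤s z≤n) (subst (_< suc k) r≡ (m%n<n K (suc k))))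
    where open ≡-Reasoning

HasOddPeriod : Permutation′ n → Fin n → Set
HasOddPeriod z i = ∃[ K ] Odd K × iter z K i ≡ i

allCyclesOdd⇒hasOddPeriod : (z : Permutation′ n) → AllCyclesOdd z → ∀ i → HasOddPeriod z i
allCyclesOdd⇒hasOddPeriod z odd i with cycleLen-exists z i
... | k , cycle@(_ , period , _) = k , odd i k cycle , period

hasOddPeriod⇒allCyclesOdd : (z : Permutation′ n) → (∀ i → HasOddPeriod z i) → AllCyclesOdd z
hasOddPeriod⇒allCyclesOdd z hasOddPeriod i k cycle with hasOddPeriod i
... | K , K-odd , period = odd-∣ (cycleLen-∣ z cycle period) K-odd

-- Permutations with odd cycles as products of 3-cycles

-- Cutting a and b = z a out of the cycle (… s a b c …) of z leaves the
-- cycle (… s c …), two points shorter, and the fixed points a and b; so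
-- z = (b c a) · shortcut, and shortcut again has only odd cycles.
module Excision (z : Permutation′ n) (z-odd : AllCyclesOdd z)
                (a : Fin n) (a-moved : z ⟨$⟩ʳ a ≢ a)
                (ℓ : ℕ) (a-cycle : CycleLen z a (suc ℓ)) where

  b c s : Fin n
  b = z ⟨$⟩ʳ a
  c = z ⟨$⟩ʳ b
  s = z ⟨$⟩ˡ a

  a≢b : a ≢ b
  a≢b = ≢-sym a-moved

  b≢c : b ≢ c
  b≢c b≡c = a≢b (⟨$⟩ʳ-injective z b≡c)

  c≢a : c ≢ a
  c≢a c≡a = ¬odd-2 (z-odd a 2 (s≤s z≤n , c≡a , no-shorter-period))
    where
    no-shorter-period : ∀ m → 0 < m → m < 2 → iter z m a ≢ a
    no-shorter-period 1             _ _                 = a-moved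
    no-shorter-period (suc (suc _)) _ (s≤s (s≤s ()))

  shortcut : Permutation′ n
  shortcut = transpose b c · (transpose a b · z)

  shortcut-a : shortcut ⟨$⟩ʳ a ≡ a
  shortcut-a = trans (cong (τ b c) (τ-ʳ a b)) (τ-other b c a≢b (≢-sym c≢a))

  shortcut-b : shortcut ⟨$⟩ʳ b ≡ b
  shortcut-b = trans (cong (τ b c) (τ-other a b c≢a (≢-sym b≢c))) (τ-ʳ b c)

  shortcut-s : shortcut ⟨$⟩ʳ s ≡ c
  shortcut-s = trans (cong (λ i → τ b c (τ a b i)) (inverseʳ z)) (trans (cong (τ b c) (τ-ˡ a b)) (τ-ˡ b c))

  shortcut-other : ∀ {x} → x ≢ a → x ≢ b → x ≢ s → shortcut ⟨$⟩ʳ x ≡ z ⟨$⟩ʳ x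
  shortcut-other {x} x≢a x≢b x≢s =
    trans (cong (τ b c) (τ-other a b (x≢s ∘ zx≡a⇒x≡s) (x≢a ∘ ⟨$⟩ʳ-injective z)))
          (τ-other b c (x≢a ∘ ⟨$⟩ʳ-injective z) (x≢b ∘ ⟨$⟩ʳ-injective z))
    where
    zx≡a⇒x≡s : z ⟨$⟩ʳ x ≡ a → x ≡ s
    zx≡a⇒x≡s zx≡a = ⟨$⟩ʳ-injective z (trans zx≡a (sym (inverseʳ z)))

  bca : ThreeCycle n
  bca = cyc b c a b≢c c≢a (≢-sym a≢b)

  z≈bca·shortcut : z ≈ threeCycle bca · shortcut
  z≈bca·shortcut i = sym (begin
    τ b a (τ b c (τ b c (τ a b m))) ≡⟨ cong (τ b a) (τ-involutive b c (τ a b m)) ⟩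
    τ b a (τ a b m)                 ≡⟨ τ-comm b a (τ a b m) ⟩
    τ a b (τ a b m)                 ≡⟨ τ-involutive a b m ⟩
    m                               ∎)
    where
    open ≡-Reasoning
    m = z ⟨$⟩ʳ i

  cycles-shortcut : cycles shortcut ≡ 2 + cycles z
  cycles-shortcut = begin
    cycles shortcut                                     ≡⟨ cycles-transpose-fixed shortcut shortcut-b b≢c ⟨
    suc (cycles (transpose b c · shortcut))             ≡⟨ cong suc (cycles-cong (transpose-cancelˡ b c (transpose a b · z))) ⟩
    suc (cycles (transpose a b · z))                    ≡⟨ cong suc (cycles-transpose-fixed (transpose a b · z) (τ-ʳ a b) a≢b) ⟨
    suc (suc (cycles (transpose a b · (transpose a b · z)))) ≡⟨ cong (2 +_) (cycles-cong (transpose-cancelˡ a b z)) ⟩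
    2 + cycles z                                        ∎
    where open ≡-Reasoning

  orbit : ℕ → Fin n
  orbit x = iter z x a

  orbit-ℓ : orbit ℓ ≡ s
  orbit-ℓ = ⟨$⟩ʳ-injective z (trans (proj₁ (proj₂ a-cycle)) (sym (inverseʳ z)))

  orbit-injective : ∀ {x y} → x ≤ ℓ → y ≤ ℓ → orbit x ≡ orbit y → x ≡ y
  orbit-injective x≤ℓ y≤ℓ = cycleLen-injective z a-cycle (s≤s x≤ℓ) (s≤s y≤ℓ)

  shortcut-orbit : ∀ {y} → 2 ≤ y → y < ℓ → shortcut ⟨$⟩ʳ orbit y ≡ orbit (suc y)
  shortcut-orbit {y} 2≤y y<ℓ = shortcut-other y≢0 y≢1 y≢ℓ
    where
    y≤ℓ = <⇒≤ y<ℓ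
    y≢0 : orbit y ≢ a
    y≢0 eq with () ← subst (2 ≤_) (orbit-injective y≤ℓ z≤n eq) 2≤y
    y≢1 : orbit y ≢ b
    y≢1 eq with s≤s () ← subst (2 ≤_) (orbit-injective y≤ℓ (≤-trans (≤-trans (n≤1+n 1) 2≤y) y≤ℓ) eq) 2≤y
    y≢ℓ : orbit y ≢ s
    y≢ℓ eq = <⇒≢ y<ℓ (orbit-injective y≤ℓ ≤-refl (trans eq (sym orbit-ℓ)))

  walk : ∀ {x} m → 2 ≤ x → x + m ≤ ℓ → iter shortcut m (orbit x) ≡ orbit (x + m)
  walk {x} zero    _   _       = cong orbit (sym (+-identityʳ x))
  walk {x} (suc m) 2≤x x+1+m≤ℓ = begin
    shortcut ⟨$⟩ʳ iter shortcut m (orbit x) ≡⟨ cong (shortcut ⟨$⟩ʳ_) (walk m 2≤x (<⇒≤ x+m<ℓ)) ⟩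
    shortcut ⟨$⟩ʳ orbit (x + m)             ≡⟨ shortcut-orbit (≤-trans 2≤x (m≤m+n x m)) x+m<ℓ ⟩
    orbit (suc (x + m))                     ≡⟨ cong orbit (+-suc x m) ⟨
    orbit (x + suc m)                       ∎
    where
    open ≡-Reasoning
    x+m<ℓ : x + m < ℓ
    x+m<ℓ = subst (_≤ ℓ) (+-suc x m) x+1+m≤ℓ

  -- orbit (2 + e) → … → orbit ℓ = s → c = orbit 2 → … → orbit (2 + e)
  -- takes ℓ - 2 steps of shortcut, and ℓ + 1 is odd.
  on-orbit-hasOddPeriod : ∀ e → 2 + e ≤ ℓ → HasOddPeriod shortcut (orbit (2 + e))
  on-orbit-hasOddPeriod e 2+e≤ℓ with m≤n⇒∃[o]m+o≡n 2+e≤ℓ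
  ... | d , 2+e+d≡ℓ = e + suc d , odd-2+ (subst Odd 1+ℓ≡2+K (z-odd a (suc ℓ) a-cycle)) , (begin
    iter shortcut (e + suc d) (orbit (2 + e))                       ≡⟨ iter-+ shortcut e (suc d) _ ⟩
    iter shortcut e (shortcut ⟨$⟩ʳ iter shortcut d (orbit (2 + e)))  ≡⟨ cong (λ i → iter shortcut e (shortcut ⟨$⟩ʳ i))
                                                                         (trans (walk d (s≤s (s≤s z≤n)) (≤-reflexive 2+e+d≡ℓ))
                                                                                (trans (cong orbit 2+e+d≡ℓ) orbit-ℓ)) ⟩
    iter shortcut e (shortcut ⟨$⟩ʳ s)                               ≡⟨ cong (iter shortcut e) shortcut-s ⟩
    iter shortcut e (orbit 2)                                       ≡⟨ walk e ≤-refl 2+e≤ℓ ⟩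
    orbit (2 + e)                                                   ∎)
    where
    open ≡-Reasoning
    1+ℓ≡2+K : suc ℓ ≡ 2 + (e + suc d)
    1+ℓ≡2+K = trans (cong suc (sym 2+e+d≡ℓ)) (cong (2 +_) (sym (+-suc e d)))

  off-orbit-hasOddPeriod : ∀ {i} → (∀ x → orbit x ≢ i) → HasOddPeriod shortcut i
  off-orbit-hasOddPeriod {i} off with allCyclesOdd⇒hasOddPeriod z z-odd i
  ... | K , K-odd@(m , refl) , period = K , K-odd , trans (agrees K) period
    where
    avoids-a : ∀ j → iter z j i ≢ a
    avoids-a j eq = off (j * (2 * m)) (begin
      iter z (j * (2 * m)) a              ≡⟨ cong (iter z (j * (2 * m))) eq ⟨
      iter z (j * (2 * m)) (iter z j i)   ≡⟨ iter-+ z (j * (2 * m)) j i ⟨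
      iter z (j * (2 * m) + j) i          ≡⟨ cong (λ k → iter z k i) (trans (+-comm (j * (2 * m)) j) (sym (*-suc j (2 * m)))) ⟩
      iter z (j * K) i                    ≡⟨ iter-periodic-* z period j ⟩
      i                                   ∎)
      where open ≡-Reasoning
    avoids-b : ∀ j → iter z j i ≢ b
    avoids-b zero    eq = off 1 (sym eq)
    avoids-b (suc j) eq = avoids-a j (⟨$⟩ʳ-injective z eq)
    avoids-s : ∀ j → iter z j i ≢ s
    avoids-s j eq = avoids-a (suc j) (trans (cong (z ⟨$⟩ʳ_) eq) (inverseʳ z))
    agrees : ∀ j → iter shortcut j i ≡ iter z j i
    agrees zero    = refl
    agrees (suc j) = trans (cong (shortcut ⟨$⟩ʳ_) (agrees j))
                           (shortcut-other (avoids-a j) (avoids-b j) (avoids-s j))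

  shortcut-odd : AllCyclesOdd shortcut
  shortcut-odd = hasOddPeriod⇒allCyclesOdd shortcut hasOddPeriod
    where
    on-orbit : ∀ {i} x → x ≤ ℓ → orbit x ≡ i → HasOddPeriod shortcut i
    on-orbit 0                   _     refl = 1 , (0 , refl) , shortcut-a
    on-orbit 1                   _     refl = 1 , (0 , refl) , shortcut-b
    on-orbit (suc (suc e)) 2+e≤ℓ refl = on-orbit-hasOddPeriod e 2+e≤ℓ
    hasOddPeriod : ∀ i → HasOddPeriod shortcut i
    hasOddPeriod i with Fin.any? {n = suc ℓ} (λ x → orbit (toℕ x) ≟ i)
    ... | yes (x , eq) = on-orbit (toℕ x) (≤-pred (Fin.toℕ<n x)) eq
    ... | no ¬on = off-orbit-hasOddPeriod λ x eq →
      ¬on (fromℕ< (m%n<n x (suc ℓ)) , (begin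
        orbit (toℕ (fromℕ< (m%n<n x (suc ℓ)))) ≡⟨ cong orbit (Fin.toℕ-fromℕ< (m%n<n x (suc ℓ))) ⟩
        orbit (x % suc ℓ)                      ≡⟨ iter-periodic-% z (proj₁ (proj₂ a-cycle)) x ⟨
        orbit x                                ≡⟨ eq ⟩
        i                                      ∎))
      where open ≡-Reasoning

  prepend-bca : ∃[ j ] 2 * j + cycles shortcut ≤ n × Prod3 j shortcut →
                ∃[ j ] 2 * j + cycles z ≤ n × Prod3 j z
  prepend-bca (j , 2j+cycles≤n , cs , refl , prod≈shortcut) =
    suc j , bound , bca ∷ cs , refl ,
    λ i → trans (cong (threeCycle bca ⟨$⟩ʳ_) (prod≈shortcut i)) (sym (z≈bca·shortcut i))
    where
    open ≤-Reasoning
    bound : 2 * suc j + cycles z ≤ n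
    bound = begin
      2 * suc j + cycles z       ≡⟨ cong (_+ cycles z) (*-suc 2 j) ⟩
      2 + (2 * j + cycles z)     ≡⟨ trans (+-suc (2 * j) _) (cong suc (+-suc (2 * j) _)) ⟨
      2 * j + (2 + cycles z)     ≡⟨ cong (2 * j +_) cycles-shortcut ⟨
      2 * j + cycles shortcut    ≤⟨ 2j+cycles≤n ⟩
      n                          ∎

allCyclesOdd⇒Prod3 : (z : Permutation′ n) → AllCyclesOdd z →
                     ∃[ j ] 2 * j + cycles z ≤ n × Prod3 j z
allCyclesOdd⇒Prod3 {n} z z-odd = bounded n z z-odd (m≤m+n n (cycles z))
  where
  bounded : ∀ k (z : Permutation′ n) → AllCyclesOdd z → n ≤ k + cycles z →
            ∃[ j ] 2 * j + cycles z ≤ n × Prod3 j z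
  bounded k z z-odd bound with Fin.all? (λ a → z ⟨$⟩ʳ a ≟ a)
  ... | yes fixed = 0 , ≤-reflexive (trans (cycles-cong fixed) cycles-id) , [] , refl , λ i → sym (fixed i)
  ... | no ¬fixed with Fin.¬∀⟶∃¬ n _ (λ a → z ⟨$⟩ʳ a ≟ a) ¬fixed
  ...   | a , a-moved with cycleLen-exists z a
  ...     | suc ℓ , a-cycle = step k bound
    where
    open Excision z z-odd a a-moved ℓ a-cycle
    step : ∀ k → n ≤ k + cycles z → ∃[ j ] 2 * j + cycles z ≤ n × Prod3 j z
    step zero bound = contradiction (begin-strict
      n               ≤⟨ bound ⟩
      cycles z        <⟨ m<n+m (cycles z) (s≤s z≤n) ⟩
      2 + cycles z    ≡⟨ cycles-shortcut ⟨
      cycles shortcut ≤⟨ cycles-≤ shortcut ⟩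
      n               ∎) (<-irrefl refl)
      where open ≤-Reasoning
    step (suc k) bound = prepend-bca (bounded k shortcut shortcut-odd bound′)
      where
      open ≤-Reasoning
      bound′ : n ≤ k + cycles shortcut
      bound′ = begin
        n                   ≤⟨ bound ⟩
        suc k + cycles z    ≡⟨ +-suc k (cycles z) ⟨
        k + suc (cycles z)  ≤⟨ +-monoʳ-≤ k (n≤1+n _) ⟩
        k + (2 + cycles z)  ≡⟨ cong (k +_) cycles-shortcut ⟨
        k + cycles shortcut ∎
  ...     | zero , () , _

-- Lengths

prod-++ : {G : Set} (g : G → Permutation′ n) (xs ys : List G) →
          prod g (xs ++ ys) ≈ prod g xs · prod g ys
prod-++ g []       ys i = refl
prod-++ g (x ∷ xs) ys i = cong (g x ⟨$⟩ʳ_) (prod-++ g xs ys i)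

ProdTransp-≈ : ∀ {m} (x y : Permutation′ n) → x ≈ y → ProdTransp m x → ProdTransp m y
ProdTransp-≈ _ _ x≈y (ts , length≡m , prod≈x) = ts , length≡m , λ i → trans (prod≈x i) (x≈y i)

ProdTransp-· : ∀ {k m} (x y : Permutation′ n) → ProdTransp k x → ProdTransp m y → ProdTransp (k + m) (x · y)
ProdTransp-· x _ (ts , refl , prod≈x) (us , refl , prod≈y) =
  ts ++ us , length-++ ts ,
  λ i → trans (prod-++ transp ts us i) (trans (prod≈x _) (cong (x ⟨$⟩ʳ_) (prod≈y i)))

threeCycle-ProdTransp : (t : ThreeCycle n) → ProdTransp 2 (threeCycle t)
threeCycle-ProdTransp (cyc a b c a≢b _ a≢c) = tr a c a≢c ∷ tr a b a≢b ∷ [] , refl , λ _ → refl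

prod3-ProdTransp : (cs : List (ThreeCycle n)) → ProdTransp (2 * length cs) (prod threeCycle cs)
prod3-ProdTransp []       = [] , refl , λ _ → refl
prod3-ProdTransp (t ∷ cs) = subst (λ m → ProdTransp m (prod threeCycle (t ∷ cs))) (sym (*-suc 2 (length cs)))
                              (ProdTransp-· (threeCycle t) (prod threeCycle cs) (threeCycle-ProdTransp t) (prod3-ProdTransp cs))

Prod3⇒ProdTransp : ∀ {k} (z : Permutation′ n) → Prod3 k z → ProdTransp (2 * k) z
Prod3⇒ProdTransp z (cs , refl , prod≈z) = ProdTransp-≈ (prod threeCycle cs) z prod≈z (prod3-ProdTransp cs)

IsLen₃⇒IsLen₂ : ∀ {k} (z : Permutation′ n) → AllCyclesOdd z → IsLen₃ z k → IsLen₂ z (2 * k)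
IsLen₃⇒IsLen₂ {n} {k} z z-odd (prod₃ , minimal₃) with allCyclesOdd⇒Prod3 z z-odd
... | j , 2j+cycles≤n , prod₃-j = Prod3⇒ProdTransp z prod₃ , no-shorter
  where
  no-shorter : ∀ m → m < 2 * k → ¬ ProdTransp m z
  no-shorter m m<2k prod₂ with k ≤? j
  ... | no  k≰j = minimal₃ j (≰⇒> k≰j) prod₃-j
  ... | yes k≤j = <⇒≱ m<2k (+-cancelʳ-≤ (cycles z) (2 * k) m (begin
    2 * k + cycles z ≤⟨ +-monoˡ-≤ (cycles z) (*-monoʳ-≤ 2 k≤j) ⟩
    2 * j + cycles z ≤⟨ 2j+cycles≤n ⟩
    n                ≤⟨ ProdTransp⇒n≤ z prod₂ ⟩
    m + cycles z     ∎))
    where open ≤-Reasoning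

IsLen₂-⁻¹· : ∀ {a b} (x y : Permutation′ n) → ProdTransp a x → IsLen₂ y (a + b) →
             ProdTransp b (x ⁻¹ · y) → IsLen₂ (x ⁻¹ · y) b
IsLen₂-⁻¹· {a = a} x y prod-x (_ , minimal-y) prod-x⁻¹y = prod-x⁻¹y , λ m m<b prod-m →
  minimal-y (a + m) (+-monoʳ-< a m<b) (ProdTransp-≈ (x · (x ⁻¹ · y)) y (λ _ → inverseʳ x) (ProdTransp-· x (x ⁻¹ · y) prod-x prod-m))

proposition4p3 : (N : ℕ) (x y : Permutation′ N) →
    Alternating x → Alternating y →
    AllCyclesOdd x → AllCyclesOdd y →
    x ≤₃ y → x ≤₂ y
proposition4p3 N x y _ _ x-odd y-odd (a , b , x-len₃ , x⁻¹y-len₃ , y-len₃) =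
  2 * a , 2 * b , x-len₂ ,
  IsLen₂-⁻¹· x y (proj₁ x-len₂) y-len₂ (Prod3⇒ProdTransp (x ⁻¹ · y) (proj₁ x⁻¹y-len₃)) ,
  y-len₂
  where
  x-len₂ : IsLen₂ x (2 * a)
  x-len₂ = IsLen₃⇒IsLen₂ x x-odd x-len₃
  y-len₂ : IsLen₂ y (2 * a + 2 * b)
  y-len₂ = subst (IsLen₂ y) (*-distribˡ-+ 2 a b) (IsLen₃⇒IsLen₂ y y-odd y-len₃)
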